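{- Let $d\ge2$, $G\in\mathcal{S}_d$, and let $H$ be obtained from $G$ by an edge subdivision step on an edge $e=(a,b)$. Then for every $(d-2)$-dimensional simplex $z$ contained in $\hat e$, the degree of $z$ in $H$ equals its degree in $G$ plus $1$.
   Context: All graphs are finite simple graphs. For a vertex $x$, $S(x)$ is the subgraph induced by the neighbors of $x$. Contractibility: $K_1$ is contractible, and $G$ is contractible if it has a vertex $x$ with $S(x)$ and $G-\{x\}$ both contractible. Spheres: $\mathcal{S}_{ -1}=\{\emptyset\}$; for $d\ge0$, $G\in\mathcal{S}_d$ if $S(x)\in\mathcal{S}_{d-1}$ for all vertices $x$ and $G-\{v\}$ is contractible for some vertex $v$. A $k$-dimensional simplex is a complete subgraph with $k+1$ vertices. For a subgraph $K$ of $G$, $\hat K$ is the subgraph induced by the vertices adjacent to every vertex of $K$. For a $(d-2)$-dimensional simplex $z$ of a graph in $\mathcal{S}_d$, $\hat z$ is a cyclic graph, and the degree of $z$ is its number of vertices. An edge subdivision step on $e=(a,b)$ removes the edge $(a,b)$, adds a new vertex $x$ with edges $(a,x),(x,b)$, and joins $x$ to every vertex of $\hat e=S(a)\cap S(b)$. -}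

module Defs where

open import Data.Nat using (ℕ; zero; suc; _≟_; _≡ᵇ_)
open import Data.Nat.Properties using (≡ᵇ⇒≡)
open import Data.Unit using (tt)
open import Data.Bool using (Bool; true; false; _∧_; _∨_; not; if_then_else_; T)
open import Data.Bool.Properties using (∧-comm; ∨-comm; T?)
open import Data.List using (List; []; _∷_; length; filterᵇ)
open import Data.List.Membership.Propositional using (_∈_; _∉_)
open import Data.List.Membership.DecPropositional _≟_ using (_∈?_)
open import Data.List.Relation.Unary.All using (All)
open import Data.List.Relation.Unary.All.Properties using (¬Any⇒All¬)
open import Data.List.Relation.Unary.AllPairs using (AllPairs; _∷_)
open import Data.List.Relation.Unary.Unique.Propositional using (Unique)
import Data.List.Relation.Unary.Unique.Propositional.Properties as UP
open import Data.Product using (Σ; _×_; _,_)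
open import Relation.Nullary using (does; yes; no; ¬_)
open import Relation.Binary.PropositionalEquality using (_≡_; refl; sym; cong; cong₂; subst)
open import Function using (_∘_)
open import Data.Empty using (⊥-elim)

-- Finite simple graphs: vertices are a finite list of distinct natural
-- number labels; adjacency is a decidable (Boolean), symmetric,
-- irreflexive relation (only its restriction to the vertices matters).

record Graph : Set where
  field
    verts  : List ℕ
    uniq   : Unique verts
    adj    : ℕ → ℕ → Bool
    adjSym : ∀ u v → adj u v ≡ adj v u
    adjIrr : ∀ u → adj u u ≡ false
open Graph public

induce : (G : Graph) → (ℕ → Bool) → Graph
induce G P = record
  { verts  = filterᵇ P (verts G)
  ; uniq   = UP.filter⁺ (T? ∘ P) (uniq G)
  ; adj    = adj G
  ; adjSym = adjSym G
  ; adjIrr = adjIrr G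
  }

adjAll : Graph → List ℕ → ℕ → Bool
adjAll G []      y = true
adjAll G (k ∷ K) y = adj G k y ∧ adjAll G K y

hat : Graph → List ℕ → Graph
hat G K = induce G (adjAll G K)

S : Graph → ℕ → Graph
S G x = hat G (x ∷ [])

delete : Graph → ℕ → Graph
delete G x = induce G (λ y → not (does (y ≟ x)))

data Contractible : Graph → Set where
  k1   : ∀ {G} v → verts G ≡ v ∷ [] → Contractible G
  step : ∀ {G} x → x ∈ verts G → Contractible (S G x)
       → Contractible (delete G x) → Contractible G

-- Sph n G  means  G ∈ 𝒮_{n-1}  (so Sph 0 is 𝒮_{-1} = {∅}).
Sph : ℕ → Graph → Set
Sph zero    G = verts G ≡ []
Sph (suc n) G = (∀ x → x ∈ verts G → Sph n (S G x))
              × Σ ℕ (λ v → v ∈ verts G × Contractible (delete G v))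

IsSphere : ℕ → Graph → Set
IsSphere d G = Sph (suc d) G

IsSimplex : Graph → ℕ → List ℕ → Set
IsSimplex G k z = length z ≡ suc k × Unique z × All (_∈ verts G) z
                × AllPairs (λ u v → adj G u v ≡ true) z

degree : Graph → List ℕ → ℕ
degree G z = length (verts (hat G z))

module _ (G : Graph) (a b x : ℕ) where
  -- x is joined to a, b and every vertex of ê = S(a) ∩ S(b)
  newAdj : ℕ → Bool
  newAdj w = (w ≡ᵇ a) ∨ (w ≡ᵇ b)
           ∨ (does (w ∈? verts G) ∧ (adj G a w ∧ adj G b w))

  isE : ℕ → ℕ → Bool
  isE u v = ((u ≡ᵇ a) ∧ (v ≡ᵇ b)) ∨ ((u ≡ᵇ b) ∧ (v ≡ᵇ a))

  oldAdj : ℕ → ℕ → Bool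
  oldAdj u v = adj G u v ∧ not (isE u v)

  subAdj : ℕ → ℕ → Bool
  subAdj u v = if u ≡ᵇ x then newAdj v
               else (if v ≡ᵇ x then newAdj u else oldAdj u v)

  isE-sym : ∀ u v → isE u v ≡ isE v u
  isE-sym u v
    rewrite ∧-comm (u ≡ᵇ a) (v ≡ᵇ b)
          | ∧-comm (u ≡ᵇ b) (v ≡ᵇ a)
    = ∨-comm ((v ≡ᵇ b) ∧ (u ≡ᵇ a)) ((v ≡ᵇ a) ∧ (u ≡ᵇ b))

  subSym : ∀ u v → subAdj u v ≡ subAdj v u
  subSym u v with u ≡ᵇ x in eu | v ≡ᵇ x in ev
  ... | true  | true  rewrite ≡ᵇ⇒≡ u x (subst T (sym eu) tt)
                            | ≡ᵇ⇒≡ v x (subst T (sym ev) tt) = refl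
  ... | true  | false = refl
  ... | false | true  = refl
  ... | false | false = cong₂ _∧_ (adjSym G u v) (cong not (isE-sym u v))

  module _ (a∈ : a ∈ verts G) (b∈ : b ∈ verts G) (x∉ : x ∉ verts G) where
    private
      x≢a : ¬ x ≡ a
      x≢a refl = x∉ a∈
      x≢b : ¬ x ≡ b
      x≢b refl = x∉ b∈
      fb : ∀ {m n} → ¬ m ≡ n → (m ≡ᵇ n) ≡ false
      fb {m} {n} ne with m ≡ᵇ n in e
      ... | true  = ⊥-elim (ne (≡ᵇ⇒≡ m n (subst T (sym e) tt)))
      ... | false = refl

    subIrr : ∀ u → subAdj u u ≡ false
    subIrr u with u ≡ᵇ x in eu
    ... | false rewrite adjIrr G u = refl
    ... | true with ≡ᵇ⇒≡ u x (subst T (sym eu) tt)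
    ... | refl rewrite fb x≢a | fb x≢b with u ∈? verts G
    ...   | yes r = ⊥-elim (x∉ r)
    ...   | no _  = refl

    subdivide : Graph
    subdivide = record
      { verts  = x ∷ verts G
      ; uniq   = ¬Any⇒All¬ (verts G) x∉ ∷ uniq G
      ; adj    = subAdj
      ; adjSym = subSym
      ; adjIrr = subIrr
      }

module Submission where

-- A vertex k of ê = S(a) ∩ S(b) is adjacent to a and b, hence differs from
-- a and b, and (being an old vertex) from x.  The subdivision only alters
-- adjacencies at x and on the pair {a,b}, so
--   * for every old vertex w, k ~_H w  iff  k ~_G w, and
--   * k ~_H x, because x is joined to every vertex of ê.

open import Defs
open import Data.Nat using (ℕ; suc; _≤_; _∸_; _≡ᵇ_; _≟_)
open import Data.Bool using (Bool; true; false; _∧_; _∨_)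
open import Data.Bool.Properties using (T?; ∧-identityʳ; ∨-zeroʳ)
open import Data.List using (List; _∷_; []; filterᵇ; length)
open import Data.List.Membership.Propositional using (_∈_; _∉_)
open import Data.List.Membership.Propositional.Properties using (∈-filter⁻)
open import Data.List.Membership.DecPropositional _≟_ using (_∈?_)
open import Data.List.Relation.Unary.Any using (here; there)
open import Data.List.Relation.Unary.All using (All; []; _∷_)
open import Data.Product using (_×_; _,_)
open import Function using (_∘_)
open import Relation.Nullary using (¬_)
open import Relation.Nullary.Decidable using (dec-true; dec-false)
open import Relation.Binary.PropositionalEquality
  using (_≡_; refl; sym; trans; cong; cong₂)

≡ᵇ-refl : ∀ n → (n ≡ᵇ n) ≡ true
≡ᵇ-refl n = dec-true (n ≟ n) refl

≢⇒≡ᵇ-false : ∀ {m n} → ¬ m ≡ n → (m ≡ᵇ n) ≡ false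
≢⇒≡ᵇ-false {m} {n} = dec-false (m ≟ n)

filterᵇ-cong : ∀ {A : Set} (P Q : A → Bool) xs → (∀ w → w ∈ xs → P w ≡ Q w)
  → filterᵇ P xs ≡ filterᵇ Q xs
filterᵇ-cong P Q []       P≗Q = refl
filterᵇ-cong P Q (y ∷ xs) P≗Q with P y | Q y | P≗Q y (here refl)
... | true  | true  | refl = cong (y ∷_) (filterᵇ-cong P Q xs (λ w → P≗Q w ∘ there))
... | false | false | refl = filterᵇ-cong P Q xs (λ w → P≗Q w ∘ there)

adjacent⇒distinct : ∀ (G : Graph) {u k} → adj G u k ≡ true → ¬ k ≡ u
adjacent⇒distinct G {k = k} uk refl with trans (sym uk) (adjIrr G k)
... | ()

hat-edge-vertex : ∀ (G : Graph) {a b k} → k ∈ verts (hat G (a ∷ b ∷ []))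
  → k ∈ verts G × adj G a k ≡ true × adj G b k ≡ true
hat-edge-vertex G {a} {b} {k} k∈ with ∈-filter⁻ (T? ∘ adjAll G (a ∷ b ∷ [])) k∈
... | k∈G , _ with adj G a k | adj G b k
... | true | true = k∈G , refl , refl

module Subdivision (G : Graph) (a b x : ℕ)
  (a∈ : a ∈ verts G) (b∈ : b ∈ verts G) (x∉ : x ∉ verts G) where

  H : Graph
  H = subdivide G a b x a∈ b∈ x∉

  ê : List ℕ
  ê = verts (hat G (a ∷ b ∷ []))

  adj-unchanged : ∀ {u w} → ¬ u ≡ x → ¬ w ≡ x → ¬ u ≡ a → ¬ u ≡ b
    → adj H u w ≡ adj G u w
  adj-unchanged {u} {w} u≢x w≢x u≢a u≢b
    rewrite ≢⇒≡ᵇ-false u≢x | ≢⇒≡ᵇ-false w≢x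
          | ≢⇒≡ᵇ-false u≢a | ≢⇒≡ᵇ-false u≢b = ∧-identityʳ (adj G u w)

  adj-new : ∀ {k} → k ∈ verts G → adj G a k ≡ true → adj G b k ≡ true
    → adj H k x ≡ true
  adj-new {k} k∈G ak bk
    rewrite ≢⇒≡ᵇ-false {k} {x} (λ { refl → x∉ k∈G }) | ≡ᵇ-refl x
          | dec-true (k ∈? verts G) k∈G | ak | bk
    = trans (cong ((k ≡ᵇ a) ∨_) (∨-zeroʳ (k ≡ᵇ b))) (∨-zeroʳ (k ≡ᵇ a))

  adjAll-new : ∀ z → All (_∈ ê) z → adjAll H z x ≡ true
  adjAll-new []      []         = refl
  adjAll-new (k ∷ z) (k∈ ∷ z⊆ê) with hat-edge-vertex G k∈
  ... | k∈G , ak , bk = cong₂ _∧_ (adj-new k∈G ak bk) (adjAll-new z z⊆ê)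

  adjAll-old : ∀ z → All (_∈ ê) z → ∀ {w} → w ∈ verts G
    → adjAll H z w ≡ adjAll G z w
  adjAll-old []      []         w∈G = refl
  adjAll-old (k ∷ z) (k∈ ∷ z⊆ê) w∈G with hat-edge-vertex G k∈
  ... | k∈G , ak , bk = cong₂ _∧_
    (adj-unchanged (λ { refl → x∉ k∈G }) (λ { refl → x∉ w∈G })
                   (adjacent⇒distinct G ak) (adjacent⇒distinct G bk))
    (adjAll-old z z⊆ê w∈G)

  -- ẑ gains exactly the new vertex x, so the degree of z grows by one.
  degree-subdivide : ∀ z → All (_∈ ê) z → degree H z ≡ suc (degree G z)
  degree-subdivide z z⊆ê rewrite adjAll-new z z⊆ê =
    cong (suc ∘ length)
      (filterᵇ-cong (adjAll H z) (adjAll G z) (verts G) (λ w → adjAll-old z z⊆ê))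

-- Theorem: for d ≥ 2 and G ∈ 𝒮_d, subdividing the edge (a,b) raises the
-- degree of every (d-2)-simplex z of ê by one.
mainTheorem11 : (d : ℕ) → 2 ≤ d → (G : Graph) → IsSphere d G
    → (a b : ℕ) → (a∈ : a ∈ verts G) → (b∈ : b ∈ verts G) → adj G a b ≡ true
    → (x : ℕ) → (x∉ : x ∉ verts G)
    → (z : List ℕ) → IsSimplex (hat G (a ∷ b ∷ [])) (d ∸ 2) z
    → degree (subdivide G a b x a∈ b∈ x∉) z ≡ suc (degree G z)
mainTheorem11 _ _ G _ a b a∈ b∈ _ x x∉ z (_ , _ , z⊆ê , _) =
  Subdivision.degree-subdivide G a b x a∈ b∈ x∉ z z⊆ê
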